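{- Let $A=\{u_1,\dots,u_a\}$ and $B=\{v_1,\dots,v_b\}$ be disjoint vertex sets with $a\ge 3$ and $b\ge 1$. Let $G_1,G_2,G_3$ be graphs on the vertex set $A\cup B$ such that every vertex of $B$ is an isolated vertex in $G_1$, and every edge of $G_i$ ($i=2,3$) contains at least one vertex of $A$. Suppose there are no two disjoint edges such that either (i) one is from $G_1$ and the other is from $G_2$ or $G_3$; or (ii) one is from $G_2$, the other is from $G_3$, and at least one of them contains a vertex of $B$. Then $$\sum_{i=1}^3\left(\deg_{G_i}(u_1)+\deg_{G_i}(u_2)+\deg_{G_i}(v_1)\right) \le \max\{4a+7,\ 3a+2b+5\}.$$
   Context: $\deg_{G}(v)$ denotes the number of neighbors of $v$ in the graph $G$. Graphs are simple. -}

module Defs where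

open import Data.Nat using (ℕ; suc; _+_; _*_; _⊔_)
open import Data.Fin using (Fin)
open import Data.Sum using (_⊎_; inj₁; inj₂)
open import Data.Product using (_×_)
open import Data.List using (List; map; _++_; length; filter)
open import Data.List.Base using (allFin)
open import Data.Empty using (⊥)
open import Relation.Nullary using (¬_; Dec)
open import Relation.Binary.PropositionalEquality using (_≡_)
open import Level using (0ℓ)

record SimpleGraph (V : Set) : Set₁ where
  field
    Adj      : V → V → Set
    adj?     : (x y : V) → Dec (Adj x y)
    symm     : ∀ {x y} → Adj x y → Adj y x
    irrefl   : ∀ {x} → ¬ Adj x x

open SimpleGraph public

Vtx : ℕ → ℕ → Set
Vtx a b = Fin a ⊎ Fin b

vertices : (a b : ℕ) → List (Vtx a b)
vertices a b = map inj₁ (allFin a) ++ map inj₂ (allFin b)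

deg : {a b : ℕ} → SimpleGraph (Vtx a b) → Vtx a b → ℕ
deg {a} {b} G v = length (filter (adj? G v) (vertices a b))

InA : {a b : ℕ} → Vtx a b → Set
InA (inj₁ _) = Data.Unit.⊤ where import Data.Unit
InA (inj₂ _) = ⊥

InB : {a b : ℕ} → Vtx a b → Set
InB (inj₁ _) = ⊥
InB (inj₂ _) = Data.Unit.⊤ where import Data.Unit

-- Two edges {x,y}, {z,w} are disjoint: all four endpoints distinct
-- (x ≠ y, z ≠ w already hold by irreflexivity).
Disjoint : {V : Set} → V → V → V → V → Set
Disjoint x y z w = ¬ x ≡ z × ¬ x ≡ w × ¬ y ≡ z × ¬ y ≡ w

-- Write S(G) = deg_G u₁ + deg_G u₂ + deg_G v₁. The basic mechanism is confinement: if G has an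
-- edge pq and no edge of H at a vertex t ∉ {p, q} may be disjoint from pq, then every
-- H-neighbour of t lies in {p, q}, so t has H-degree at most 2.  Apart from that one only uses
-- that vertices of A have degree < a in G₁ (where v₁ is isolated), v₁ has degree ≤ a in G₂, G₃,
-- and every degree is < a + b.
--
-- If G₁ has an edge avoiding u₁ and one avoiding u₂, condition (i) confines u₁, u₂, v₁ in G₂ and
-- G₃. Otherwise G₁ is a star centred at u₁ (say), and the number of its leaves besides u₂ decides:
-- with two such leaves x, x′, condition (i) pins u₂ and v₁ to u₁ in G₂ and G₃; with one, the
-- degree of u₁ in G₂ trades off against those of u₂, v₁ in G₃ and vice versa; with none,
-- S(G₁) ≤ 2 and S(G₂) + S(G₃) is bounded through condition (ii) alone, according to which of
-- G₂, G₃ have a "stray" edge at u₁, u₂, v₁ meeting B other than u₁v₁, u₂v₁: a stray edge of one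
-- graph confines two of u₁, u₂, v₁ in the other.

module Submission where

open import Defs
open import Level using (0ℓ)
open import Function using (_∘_; _∘′_; id)
open import Data.Empty using (⊥; ⊥-elim)
open import Data.Unit using (tt)
open import Data.Nat using (ℕ; zero; suc; pred; _+_; _*_; _⊔_; _≤_; _<_; s≤s; z≤n)
open import Data.Nat.Properties
  using (≤-trans; ≤-reflexive; +-mono-≤; +-monoʳ-≤; +-monoˡ-≤; +-comm; +-assoc; +-suc;
         m≤m+n; m≤m⊔n; m≤n⊔m; ⊔-sel; <⇒≤pred; m<1+n⇒m≤n; m≤n⇒m≤1+n; n≤1+n; module ≤-Reasoning)
open import Data.Nat.Tactic.RingSolver using (solve; solve-∀)
open import Data.Fin using (Fin; fromℕ<; zero; suc)
import Data.Fin.Properties as Fin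
open import Data.Sum using (_⊎_; inj₁; inj₂; [_,_]; map₂; swap)
open import Data.Sum.Properties using (≡-dec; inj₁-injective; inj₂-injective)
open import Data.Product using (_×_; _,_; ∃; ∃₂)
open import Data.List using (List; []; _∷_; map; _++_; length; filter; allFin)
open import Data.List.Properties using (length-++; length-map; length-tabulate; filter-none; filter-notAll)
open import Data.List.Membership.Propositional using (_∈_; lose)
open import Data.List.Membership.Propositional.Properties using (∈-map⁺; ∈-map⁻; ∈-++⁺ˡ; ∈-++⁺ʳ; ∈-allFin)
open import Data.List.Relation.Unary.Any using (here; there; any?; satisfied)
import Data.List.Relation.Unary.All as All
open import Data.List.Relation.Unary.AllPairs using ([]; _∷_)
open import Data.List.Relation.Unary.Unique.Propositional using (Unique)
import Data.List.Relation.Unary.Unique.Propositional.Properties as Unique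
open import Data.List.Relation.Binary.Sublist.Propositional using (⊆-refl)
open import Data.List.Relation.Binary.Sublist.Propositional.Properties using (filter⁺; length-mono-≤)
open import Relation.Nullary using (¬_; Dec; yes; no; contradiction)
open import Relation.Nullary.Decidable using (map′; _×-dec_; _⊎-dec_; ¬?; decidable-stable)
open import Relation.Unary using (Pred; Decidable; _⊆_; _∪_)
open import Relation.Binary.Definitions using (DecidableEquality)
open import Relation.Binary.PropositionalEquality
  using (_≡_; _≢_; refl; sym; trans; cong; cong₂; subst; ≢-sym)

count : {V : Set} {P : Pred V 0ℓ} → Decidable P → List V → ℕ
count P? xs = length (filter P? xs)

module _ {V : Set} {P Q : Pred V 0ℓ} (P? : Decidable P) (Q? : Decidable Q) where

  count-mono : P ⊆ Q → ∀ xs → count P? xs ≤ count Q? xs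
  count-mono P⊆Q xs = length-mono-≤ (filter⁺ P? Q? (λ { refl → P⊆Q }) (⊆-refl {x = xs}))

  count-< : P ⊆ Q → ∀ {t xs} → t ∈ xs → ¬ P t → Q t → count P? xs < count Q? xs
  count-< P⊆Q {xs = x ∷ xs} (here refl) ¬Px Qx with P? x | Q? x
  ... | yes Px | _      = contradiction Px ¬Px
  ... | no _   | yes _  = s≤s (count-mono P⊆Q xs)
  ... | no _   | no ¬Qx = contradiction Qx ¬Qx
  count-< P⊆Q {xs = x ∷ xs} (there t∈xs) ¬Pt Qt with P? x | Q? x
  ... | yes Px | no ¬Qx = contradiction (P⊆Q Px) ¬Qx
  ... | yes _  | yes _  = s≤s (count-< P⊆Q t∈xs ¬Pt Qt)
  ... | no _   | yes _  = m≤n⇒m≤1+n (count-< P⊆Q t∈xs ¬Pt Qt)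
  ... | no _   | no _   = count-< P⊆Q t∈xs ¬Pt Qt

module _ {V : Set} {P Q R : Pred V 0ℓ} (P? : Decidable P) (Q? : Decidable Q) (R? : Decidable R) where

  count-⊎ : P ⊆ Q ∪ R → ∀ xs → count P? xs ≤ count Q? xs + count R? xs
  count-⊎ P⊆Q∪R xs = ≤-trans (count-mono P? Q∪R? P⊆Q∪R xs) (count-∪ xs)
    where
    Q∪R? : Decidable (Q ∪ R)
    Q∪R? x = Q? x ⊎-dec R? x

    count-∪ : ∀ xs → count Q∪R? xs ≤ count Q? xs + count R? xs
    count-∪ [] = z≤n
    count-∪ (x ∷ xs) with Q? x | R? x
    ... | yes _ | yes _ = s≤s (≤-trans (count-∪ xs) (+-monoʳ-≤ (count Q? xs) (n≤1+n _)))
    ... | yes _ | no _  = s≤s (count-∪ xs)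
    ... | no _  | yes _ = ≤-trans (s≤s (count-∪ xs)) (≤-reflexive (sym (+-suc _ _)))
    ... | no _  | no _  = count-∪ xs

count-≡≤1 : {V : Set} (_≟_ : DecidableEquality V) (p : V) {xs : List V} →
            Unique xs → count (_≟ p) xs ≤ 1
count-≡≤1 _≟_ p {[]} [] = z≤n
count-≡≤1 _≟_ p {x ∷ xs} (x∉xs ∷ xs-unique) with x ≟ p
... | yes refl = s≤s (≤-reflexive (cong length (filter-none (_≟ p) (All.map ≢-sym x∉xs))))
... | no _     = count-≡≤1 _≟_ p xs-unique

module _ {a b : ℕ} where

  _≟_ : DecidableEquality (Vtx a b)
  _≟_ = ≡-dec Fin._≟_ Fin._≟_

  InA? : Decidable (InA {a} {b})
  InA? (inj₁ _) = yes tt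
  InA? (inj₂ _) = no λ ()

  InB? : Decidable (InB {a} {b})
  InB? (inj₁ _) = no λ ()
  InB? (inj₂ _) = yes tt

  InA⊎InB : (x : Vtx a b) → InA x ⊎ InB x
  InA⊎InB (inj₁ _) = inj₁ tt
  InA⊎InB (inj₂ _) = inj₂ tt

  InA→¬InB : {x : Vtx a b} → InA x → ¬ InB x
  InA→¬InB {inj₁ _} _ ()

  A≢B : {x y : Vtx a b} → InA x → InB y → x ≢ y
  A≢B x∈A y∈B refl = InA→¬InB x∈A y∈B

  B≢A : {x y : Vtx a b} → InB x → InA y → x ≢ y
  B≢A x∈B y∈A = ≢-sym (A≢B y∈A x∈B)

  ∈-vertices : (x : Vtx a b) → x ∈ vertices a b
  ∈-vertices (inj₁ i) = ∈-++⁺ˡ (∈-map⁺ inj₁ (∈-allFin i))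
  ∈-vertices (inj₂ j) = ∈-++⁺ʳ _ (∈-map⁺ inj₂ (∈-allFin j))

  vertices-unique : Unique (vertices a b)
  vertices-unique = Unique.++⁺ (Unique.map⁺ inj₁-injective (Unique.allFin⁺ a))
                               (Unique.map⁺ inj₂-injective (Unique.allFin⁺ b))
                               A-and-B-apart
    where
    A-and-B-apart : ∀ {x} → ¬ (x ∈ map inj₁ (allFin a) × x ∈ map inj₂ (allFin b))
    A-and-B-apart (x∈A , x∈B) with ∈-map⁻ inj₁ x∈A | ∈-map⁻ inj₂ x∈B
    ... | _ , _ , refl | _ , _ , ()

  count-InA : count InA? (vertices a b) ≡ a
  count-InA = trans (count-inj₁ (allFin a) (allFin b)) (length-tabulate {n = a} id)
    where
    count-inj₁ : ∀ xs ys → count InA? (map inj₁ xs ++ map inj₂ ys) ≡ length xs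
    count-inj₁ (x ∷ xs) ys = cong suc (count-inj₁ xs ys)
    count-inj₁ [] []       = refl
    count-inj₁ [] (y ∷ ys) = count-inj₁ [] ys

  length-vertices : length (vertices a b) ≡ a + b
  length-vertices = trans (length-++ (map inj₁ (allFin a)))
    (cong₂ _+_ (trans (length-map inj₁ (allFin a)) (length-tabulate {n = a} id))
               (trans (length-map inj₂ (allFin b)) (length-tabulate {n = b} id)))

  ∃? : {P : Pred (Vtx a b) 0ℓ} → Decidable P → Dec (∃ P)
  ∃? P? = map′ satisfied (λ (x , Px) → lose (∈-vertices x) Px) (any? P? (vertices a b))

module _ {a b : ℕ} (G : SimpleGraph (Vtx a b)) (t : Vtx a b) where

  deg≤count : {P : Pred (Vtx a b) 0ℓ} (P? : Decidable P) → Adj G t ⊆ P → deg G t ≤ count P? (vertices a b)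
  deg≤count P? N⊆P = count-mono (adj? G t) P? N⊆P (vertices a b)

  deg<count : {P : Pred (Vtx a b) 0ℓ} (P? : Decidable P) → P t → Adj G t ⊆ P → deg G t < count P? (vertices a b)
  deg<count P? Pt N⊆P = count-< (adj? G t) P? N⊆P (∈-vertices t) (irrefl G) Pt

  deg≡0 : (∀ y → ¬ Adj G t y) → deg G t ≡ 0
  deg≡0 isolated = cong length (filter-none (adj? G t) (All.universal isolated (vertices a b)))

  deg≤1 : (p : Vtx a b) → (∀ {y} → Adj G t y → y ≡ p) → deg G t ≤ 1
  deg≤1 p N≡p = ≤-trans (deg≤count (_≟ p) N≡p) (count-≡≤1 _≟_ p vertices-unique)

  deg≤2 : (p q : Vtx a b) → (∀ {y} → Adj G t y → y ≡ p ⊎ y ≡ q) → deg G t ≤ 2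
  deg≤2 p q N⊆pq = ≤-trans (count-⊎ (adj? G t) (_≟ p) (_≟ q) N⊆pq (vertices a b))
    (+-mono-≤ (count-≡≤1 _≟_ p vertices-unique) (count-≡≤1 _≟_ q vertices-unique))

  deg≤a : Adj G t ⊆ InA → deg G t ≤ a
  deg≤a N⊆A = ≤-trans (deg≤count InA? N⊆A) (≤-reflexive count-InA)

  deg<a : InA t → Adj G t ⊆ InA → deg G t < a
  deg<a t∈A N⊆A = ≤-trans (deg<count InA? t∈A N⊆A) (≤-reflexive count-InA)

  deg≤a-extra : (p : Vtx a b) → InA t → (∀ {y} → Adj G t y → InA y ⊎ y ≡ p) → deg G t ≤ a
  deg≤a-extra p t∈A N⊆A∪p = m<1+n⇒m≤n (≤-trans
    (deg<count (λ y → (y ≟ p) ⊎-dec InA? y) (inj₂ t∈A) (swap ∘′ N⊆A∪p))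
    (≤-trans (count-⊎ _ (_≟ p) InA? id (vertices a b))
             (+-mono-≤ (count-≡≤1 _≟_ p vertices-unique) (≤-reflexive count-InA))))

  deg<a+b : deg G t < a + b
  deg<a+b = ≤-trans (filter-notAll (adj? G t) (vertices a b) (lose (∈-vertices t) (irrefl G)))
                    (≤-reflexive (length-vertices {a} {b}))

module _ {V : Set} (_≟_ : DecidableEquality V) where

  ¬Disjoint⇒shared : ∀ {p q t z : V} → ¬ Disjoint p q t z → p ≢ t → q ≢ t → z ≡ p ⊎ z ≡ q
  ¬Disjoint⇒shared {p} {q} {t} {z} meet p≢t q≢t with z ≟ p | z ≟ q
  ... | yes z≡p | _       = inj₁ z≡p
  ... | no _    | yes z≡q = inj₂ z≡q
  ... | no z≢p  | no z≢q  = contradiction (p≢t , ≢-sym z≢p , q≢t , ≢-sym z≢q) meet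

common-endpoint : {V : Set} {z p x y : V} → z ≡ p ⊎ z ≡ x → z ≡ p ⊎ z ≡ y → x ≢ y → z ≡ p
common-endpoint (inj₁ z≡p) _            _   = z≡p
common-endpoint (inj₂ _)   (inj₁ z≡p)   _   = z≡p
common-endpoint (inj₂ refl) (inj₂ refl) x≢y = contradiction refl x≢y

Disjoint-sym : {V : Set} {x y z w : V} → Disjoint x y z w → Disjoint z w x y
Disjoint-sym (x≢z , x≢w , y≢z , y≢w) = ≢-sym x≢z , ≢-sym y≢z , ≢-sym x≢w , ≢-sym y≢w

module _ {a b : ℕ} where

  EdgesMeetA : SimpleGraph (Vtx a b) → Set
  EdgesMeetA G = ∀ x y → Adj G x y → InA x ⊎ InA y

  NoDisjointEdges : (G H : SimpleGraph (Vtx a b)) → Set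
  NoDisjointEdges G H = ∀ x y z w → Adj G x y → Adj H z w → ¬ Disjoint x y z w

  NoDisjointBEdges : (G H : SimpleGraph (Vtx a b)) → Set
  NoDisjointBEdges G H = ∀ x y z w → Adj G x y → Adj H z w →
    InB x ⊎ InB y ⊎ InB z ⊎ InB w → ¬ Disjoint x y z w

  NoDisjointBEdges-sym : ∀ {G H} → NoDisjointBEdges G H → NoDisjointBEdges H G
  NoDisjointBEdges-sym nd x y z w Hxy Gzw B-end = nd z w x y Gzw Hxy (rotate B-end) ∘ Disjoint-sym
    where
    rotate : ∀ {P Q R S : Set} → P ⊎ Q ⊎ R ⊎ S → R ⊎ S ⊎ P ⊎ Q
    rotate (inj₁ p)               = inj₂ (inj₂ (inj₁ p))
    rotate (inj₂ (inj₁ q))        = inj₂ (inj₂ (inj₂ q))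
    rotate (inj₂ (inj₂ (inj₁ r))) = inj₁ r
    rotate (inj₂ (inj₂ (inj₂ s))) = inj₂ (inj₁ s)

  module _ (G H : SimpleGraph (Vtx a b)) {p q t : Vtx a b} where

    edge-confines : NoDisjointEdges G H → Adj G p q → p ≢ t → q ≢ t →
                    ∀ {z} → Adj H t z → z ≡ p ⊎ z ≡ q
    edge-confines nd pq p≢t q≢t tz = ¬Disjoint⇒shared _≟_ (nd _ _ _ _ pq tz) p≢t q≢t

    B-edge-confines : NoDisjointBEdges G H → Adj G p q → InB p ⊎ InB q → p ≢ t → q ≢ t →
                      ∀ {z} → Adj H t z → z ≡ p ⊎ z ≡ q
    B-edge-confines nd pq B-end p≢t q≢t tz =
      ¬Disjoint⇒shared _≟_ (nd _ _ _ _ pq tz (map₂ inj₁ B-end)) p≢t q≢t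

    B-edge-deg≤2 : NoDisjointBEdges G H → Adj G p q → InB p ⊎ InB q → p ≢ t → q ≢ t → deg H t ≤ 2
    B-edge-deg≤2 nd pq B-end p≢t q≢t = deg≤2 H t p q (B-edge-confines nd pq B-end p≢t q≢t)

≤-slack : ∀ {x y} s → x + s ≡ y → x ≤ y
≤-slack {x} s refl = m≤m+n x s

+-mono-≤-swap : ∀ {w x y z} → w ≤ z → x ≤ y → w + x ≤ y + z
+-mono-≤-swap {w} {x} w≤z x≤y = ≤-trans (≤-reflexive (+-comm w x)) (+-mono-≤ x≤y w≤z)

⊔-induction : (P : ℕ → Set) {x y : ℕ} → P x → P y → P (x ⊔ y)
⊔-induction P {x} {y} Px Py with ⊔-sel x y
... | inj₁ x⊔y≡x = subst P (sym x⊔y≡x) Px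
... | inj₂ x⊔y≡y = subst P (sym x⊔y≡y) Py

regroup-crosswise : ∀ c x₁ x₂ x₃ y₁ y₂ y₃ →
  c + (x₁ + x₂ + x₃) + (y₁ + y₂ + y₃) ≡ c + (x₁ + (y₂ + y₃)) + (y₁ + (x₂ + x₃))
regroup-crosswise = solve-∀

target : ℕ → ℕ → ℕ
target a b = (4 * a + 7) ⊔ (3 * a + 2 * b + 5)

≤targetˡ : ∀ a b {x} → x ≤ 4 * a + 7 → x ≤ target a b
≤targetˡ _ _ x≤ = ≤-trans x≤ (m≤m⊔n _ _)

≤targetʳ : ∀ a b {x} → x ≤ 3 * a + 2 * b + 5 → x ≤ target a b
≤targetʳ _ _ x≤ = ≤-trans x≤ (m≤n⊔m _ _)

-- Totals of the individual cases, for a = 3 + k and b = 1 + m,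
-- so that pred a = 2 + k and pred (a + b) = 2 + k + (1 + m).

no-stray-total : ∀ k m → 2 + ((3 + k + (3 + k) + 2) + (3 + k + (3 + k) + 2)) ≤ target (3 + k) (1 + m)
no-stray-total k m = ≤targetˡ (3 + k) (1 + m) (≤-slack 1 (solve (k ∷ [])))

both-stray-total : ∀ k m → let n = 2 + k + (1 + m) in
  2 + ((n + 4) + (n + 4)) ≤ target (3 + k) (1 + m)
both-stray-total k m = ≤targetʳ (3 + k) (1 + m) (≤-slack k (solve (k ∷ m ∷ [])))

spoke-total : ∀ k m → 2 + ((3 + k + 4) + (2 + k + (1 + m) + 2 + (3 + k))) ≤ target (3 + k) (1 + m)
spoke-total k zero    = ≤targetˡ (3 + k) 1 (≤-slack (2 + k) (solve (k ∷ [])))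
spoke-total k (suc m) = ≤targetʳ (3 + k) (2 + m) (≤-slack m (solve (k ∷ m ∷ [])))

pinned-total : ∀ k m → let n = 2 + k + (1 + m) in
  2 + ((1 + 1 + 0) + (n + n + (3 + k))) ≤ target (3 + k) (1 + m)
pinned-total k m = ≤targetʳ (3 + k) (1 + m) (≤-slack 3 (solve (k ∷ m ∷ [])))

lopsided-total : ∀ k m → let n = 2 + k + (1 + m) in
  2 + ((2 + k + 1 + 0) + (n + (2 + k) + 1)) ≤ target (3 + k) (1 + m)
lopsided-total k m = ≤targetʳ (3 + k) (1 + m) (≤-slack (5 + m) (solve (k ∷ m ∷ [])))

two-avoiding-total : ∀ k m → (2 + k + (2 + k) + 0) + (2 + 2 + 2) + (2 + 2 + 2) ≤ target (3 + k) (1 + m)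
two-avoiding-total k m = ≤targetˡ (3 + k) (1 + m) (≤-slack (3 + 2 * k) (solve (k ∷ [])))

star-two-leaves-total : ∀ k m → let n = 2 + k + (1 + m) in
  (2 + k + 1 + 0) + (n + 1 + 1) + (n + 1 + 1) ≤ target (3 + k) (1 + m)
star-two-leaves-total k m = ≤targetʳ (3 + k) (1 + m) (≤-slack 3 (solve (k ∷ m ∷ [])))

star-one-leaf-total : ∀ k m → let M = (3 + k + (2 + 2)) ⊔ (2 + k + (1 + m) + (1 + 1)) in
  2 + 1 + 0 + M + M ≤ target (3 + k) (1 + m)
star-one-leaf-total k m = ⊔-induction (λ M → 2 + 1 + 0 + M + M ≤ target (3 + k) (1 + m))
  {3 + k + (2 + 2)} {2 + k + (1 + m) + (1 + 1)}
  (≤targetˡ (3 + k) (1 + m) (≤-slack (2 + 2 * k) (solve (k ∷ []))))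
  (≤targetʳ (3 + k) (1 + m) (≤-slack (3 + k) (solve (k ∷ m ∷ []))))

module Bounds (k m : ℕ) where

  a b : ℕ
  a = 3 + k
  b = 1 + m

  Graph : Set₁
  Graph = SimpleGraph (Vtx a b)

  deg≤pred[a+b] : (G : Graph) (t : Vtx a b) → deg G t ≤ pred (a + b)
  deg≤pred[a+b] G t = <⇒≤pred (deg<a+b G t)

  module Triple (i₁ i₂ : Fin a) (j : Fin b) (i₁≢i₂ : i₁ ≢ i₂) where

    u₁ u₂ v : Vtx a b
    u₁ = inj₁ i₁
    u₂ = inj₁ i₂
    v  = inj₂ j

    u₁≢u₂ : u₁ ≢ u₂
    u₁≢u₂ refl = i₁≢i₂ refl

    u₁≢v : u₁ ≢ v
    u₁≢v ()

    u₂≢v : u₂ ≢ v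
    u₂≢v ()

    v≢u₁ : v ≢ u₁
    v≢u₁ ()

    v≢u₂ : v ≢ u₂
    v≢u₂ ()

    degSum : Graph → ℕ
    degSum G = deg G u₁ + deg G u₂ + deg G v

    BNbr : Graph → Vtx a b → Set
    BNbr G u = ∃ λ y → Adj G u y × InB y

    OtherBNbr : Graph → Vtx a b → Set
    OtherBNbr G u = ∃ λ y → Adj G u y × InB y × y ≢ v

    OtherNbrOfV : Graph → Set
    OtherNbrOfV G = ∃ λ z → Adj G v z × z ≢ u₁ × z ≢ u₂

    Stray : Graph → Set
    Stray G = OtherNbrOfV G ⊎ OtherBNbr G u₁ ⊎ OtherBNbr G u₂

    bNbr? : (G : Graph) (u : Vtx a b) → Dec (BNbr G u)
    bNbr? G u = ∃? λ y → adj? G u y ×-dec InB? y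

    otherBNbr? : (G : Graph) (u : Vtx a b) → Dec (OtherBNbr G u)
    otherBNbr? G u = ∃? λ y → adj? G u y ×-dec InB? y ×-dec ¬? (y ≟ v)

    otherNbrOfV? : (G : Graph) → Dec (OtherNbrOfV G)
    otherNbrOfV? G = ∃? λ z → adj? G v z ×-dec ¬? (z ≟ u₁) ×-dec ¬? (z ≟ u₂)

    stray? : (G : Graph) → Dec (Stray G)
    stray? G = otherNbrOfV? G ⊎-dec otherBNbr? G u₁ ⊎-dec otherBNbr? G u₂

    otherBNbr⇒bNbr : ∀ {G u} → OtherBNbr G u → BNbr G u
    otherBNbr⇒bNbr (y , uy , y∈B , _) = y , uy , y∈B

    module _ (G : Graph) where

      nbrs-of-v : ¬ OtherNbrOfV G → ∀ {z} → Adj G v z → z ≡ u₁ ⊎ z ≡ u₂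
      nbrs-of-v ¬other {z} vz = decidable-stable ((z ≟ u₁) ⊎-dec (z ≟ u₂))
        λ z∉u₁u₂ → ¬other (z , vz , z∉u₁u₂ ∘ inj₁ , z∉u₁u₂ ∘ inj₂)

      nbrs-in-A∪v : ∀ {u} → ¬ OtherBNbr G u → ∀ {y} → Adj G u y → InA y ⊎ y ≡ v
      nbrs-in-A∪v ¬other {y} uy with InA⊎InB y
      ... | inj₁ y∈A = inj₁ y∈A
      ... | inj₂ y∈B = inj₂ (decidable-stable (y ≟ v) λ y≢v → ¬other (y , uy , y∈B , y≢v))

      nbrs-in-A : ∀ {u} → ¬ OtherBNbr G u → ¬ Adj G u v → Adj G u ⊆ InA
      nbrs-in-A ¬other ¬uv uy = [ id , (λ { refl → contradiction uy ¬uv }) ] (nbrs-in-A∪v ¬other uy)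

      ¬BNbr⇒nbrs-in-A : ∀ {u} → ¬ BNbr G u → Adj G u ⊆ InA
      ¬BNbr⇒nbrs-in-A ¬bNbr {y} uy with InA⊎InB y
      ... | inj₁ y∈A = y∈A
      ... | inj₂ y∈B = contradiction (y , uy , y∈B) ¬bNbr

      deg≤a-no-otherBNbr : ∀ {u} → InA u → ¬ OtherBNbr G u → deg G u ≤ a
      deg≤a-no-otherBNbr u∈A ¬other = deg≤a-extra G _ v u∈A (nbrs-in-A∪v ¬other)

      deg-v≤a : EdgesMeetA G → deg G v ≤ a
      deg-v≤a meetsA = deg≤a G v λ {z} vz → [ (λ ()) , id ] (meetsA v z vz)

      deg-v≡0 : ¬ Stray G → ¬ Adj G u₁ v → ¬ Adj G u₂ v → deg G v ≡ 0
      deg-v≡0 ¬stray ¬u₁v ¬u₂v = deg≡0 G v λ z vz →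
        [ (λ { refl → ¬u₁v (symm G vz) }) , (λ { refl → ¬u₂v (symm G vz) }) ]
        (nbrs-of-v (¬stray ∘ inj₁) vz)

      unstray-bound : ¬ Stray G → degSum G ≤ a + a + 2
      unstray-bound ¬stray = +-mono-≤
        (+-mono-≤ (deg≤a-no-otherBNbr tt (¬stray ∘ inj₂ ∘ inj₁)) (deg≤a-no-otherBNbr tt (¬stray ∘ inj₂ ∘ inj₂)))
        (deg≤2 G v u₁ u₂ (nbrs-of-v (¬stray ∘ inj₁)))

      crude-bound : EdgesMeetA G → degSum G ≤ pred (a + b) + pred (a + b) + a
      crude-bound meetsA = +-mono-≤ (+-mono-≤ (deg≤pred[a+b] G u₁) (deg≤pred[a+b] G u₂)) (deg-v≤a meetsA)

    module Pair (G G′ : Graph) (B-apart : NoDisjointBEdges G G′) where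

      B-apart′ : NoDisjointBEdges G′ G
      B-apart′ = NoDisjointBEdges-sym {G = G} {H = G′} B-apart

      stray-confines : Stray G′ → ∀ {D} → deg G u₁ ≤ D → deg G u₂ ≤ D → deg G v ≤ D → degSum G ≤ D + 4
      stray-confines (inj₁ (z , vz , z≢u₁ , z≢u₂)) {D} _ _ dv = ≤-trans
        (+-mono-≤ (+-mono-≤ (B-edge-deg≤2 G′ G B-apart′ vz (inj₁ tt) v≢u₁ z≢u₁)
                            (B-edge-deg≤2 G′ G B-apart′ vz (inj₁ tt) v≢u₂ z≢u₂)) dv)
        (≤-reflexive (+-comm 4 D))
      stray-confines (inj₂ (inj₁ (y , u₁y , y∈B , y≢v))) {D} d₁ _ _ = ≤-trans
        (+-mono-≤ (+-mono-≤ d₁ (B-edge-deg≤2 G′ G B-apart′ u₁y (inj₂ y∈B) u₁≢u₂ (B≢A y∈B tt)))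
                  (B-edge-deg≤2 G′ G B-apart′ u₁y (inj₂ y∈B) u₁≢v y≢v))
        (≤-reflexive (+-assoc D 2 2))
      stray-confines (inj₂ (inj₂ (y , u₂y , y∈B , y≢v))) {D} _ d₂ _ = ≤-trans
        (+-mono-≤ (+-mono-≤-swap (B-edge-deg≤2 G′ G B-apart′ u₂y (inj₂ y∈B) (≢-sym u₁≢u₂) (B≢A y∈B tt)) d₂)
                  (B-edge-deg≤2 G′ G B-apart′ u₂y (inj₂ y∈B) u₂≢v y≢v))
        (≤-reflexive (+-assoc D 2 2))

      spoke-bound : EdgesMeetA G′ → Adj G u₁ v ⊎ Adj G u₂ v → degSum G′ ≤ pred (a + b) + 2 + a
      spoke-bound meetsA′ (inj₁ u₁v) =
        +-mono-≤ (+-mono-≤ (deg≤pred[a+b] G′ u₁) (B-edge-deg≤2 G G′ B-apart u₁v (inj₂ tt) u₁≢u₂ v≢u₂))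
                 (deg-v≤a G′ meetsA′)
      spoke-bound meetsA′ (inj₂ u₂v) =
        +-mono-≤ (+-mono-≤-swap (B-edge-deg≤2 G G′ B-apart u₂v (inj₂ tt) (≢-sym u₁≢u₂) v≢u₁) (deg≤pred[a+b] G′ u₂))
                 (deg-v≤a G′ meetsA′)

      pinned : ∀ {t p y} → Adj G t ⊆ InA → Adj G′ p y → InB y → p ≢ t → y ≢ t → deg G t ≤ 1
      pinned {t} {p} N⊆A py y∈B p≢t y≢t = deg≤1 G t p λ tz →
        [ id , (λ { refl → contradiction y∈B (InA→¬InB (N⊆A tz)) }) ]
        (B-edge-confines G′ G B-apart′ py (inj₂ y∈B) p≢t y≢t tz)

      pair-bound-spoked : EdgesMeetA G → EdgesMeetA G′ → ¬ Stray G → Stray G′ → Adj G u₁ v ⊎ Adj G u₂ v →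
                          2 + (degSum G + degSum G′) ≤ target a b
      pair-bound-spoked meetsA meetsA′ ¬stray stray′ spoke = ≤-trans
        (+-monoʳ-≤ 2 (+-mono-≤ (stray-confines stray′ (deg≤a-no-otherBNbr G tt (¬stray ∘ inj₂ ∘ inj₁))
                                                       (deg≤a-no-otherBNbr G tt (¬stray ∘ inj₂ ∘ inj₂))
                                                       (deg-v≤a G meetsA))
                               (spoke-bound meetsA′ spoke)))
        (spoke-total k m)

      pair-bound-pinned : EdgesMeetA G′ → deg G v ≡ 0 → deg G u₁ ≤ 1 → deg G u₂ ≤ 1 →
                          2 + (degSum G + degSum G′) ≤ target a b
      pair-bound-pinned meetsA′ v≡0 d₁ d₂ = ≤-trans
        (+-monoʳ-≤ 2 (+-mono-≤ (+-mono-≤ (+-mono-≤ d₁ d₂) (≤-reflexive v≡0)) (crude-bound G′ meetsA′)))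
        (pinned-total k m)

      pair-bound-lopsided : deg G v ≡ 0 → deg G u₁ + deg G u₂ ≤ pred a + 1 →
                            deg G′ u₁ + deg G′ u₂ ≤ pred (a + b) + pred a → deg G′ v ≤ 1 →
                            2 + (degSum G + degSum G′) ≤ target a b
      pair-bound-lopsided v≡0 d d′ d′v = ≤-trans
        (+-monoʳ-≤ 2 (+-mono-≤ (+-mono-≤ d (≤-reflexive v≡0)) (+-mono-≤ d′ d′v)))
        (lopsided-total k m)

      pair-bound-unspoked : EdgesMeetA G′ → ¬ Stray G → ¬ Adj G u₁ v → ¬ Adj G u₂ v → Stray G′ →
                            2 + (degSum G + degSum G′) ≤ target a b
      pair-bound-unspoked meetsA′ ¬stray ¬u₁v ¬u₂v stray′ =
        cases (otherNbrOfV? G′) (bNbr? G′ u₁) (bNbr? G′ u₂)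
        where
        N₁⊆A : Adj G u₁ ⊆ InA
        N₁⊆A = nbrs-in-A G (¬stray ∘ inj₂ ∘ inj₁) ¬u₁v

        N₂⊆A : Adj G u₂ ⊆ InA
        N₂⊆A = nbrs-in-A G (¬stray ∘ inj₂ ∘ inj₂) ¬u₂v

        v≡0 : deg G v ≡ 0
        v≡0 = deg-v≡0 G ¬stray ¬u₁v ¬u₂v

        cases : Dec (OtherNbrOfV G′) → Dec (BNbr G′ u₁) → Dec (BNbr G′ u₂) →
                2 + (degSum G + degSum G′) ≤ target a b
        cases (yes (z , vz , z≢u₁ , z≢u₂)) _ _ = pair-bound-pinned meetsA′ v≡0
          (pinned N₁⊆A (symm G′ vz) tt z≢u₁ v≢u₁) (pinned N₂⊆A (symm G′ vz) tt z≢u₂ v≢u₂)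
        cases (no _) (yes (y₁ , u₁y₁ , y₁∈B)) (yes (y₂ , u₂y₂ , y₂∈B)) = pair-bound-pinned meetsA′ v≡0
          (pinned N₁⊆A u₂y₂ y₂∈B (≢-sym u₁≢u₂) (B≢A y₂∈B tt)) (pinned N₂⊆A u₁y₁ y₁∈B u₁≢u₂ (B≢A y₁∈B tt))
        cases (no ¬other) (yes (y₁ , u₁y₁ , y₁∈B)) (no ¬bNbr₂) = pair-bound-lopsided v≡0
          (+-mono-≤ (<⇒≤pred (deg<a G u₁ tt N₁⊆A)) (pinned N₂⊆A u₁y₁ y₁∈B u₁≢u₂ (B≢A y₁∈B tt)))
          (+-mono-≤ (deg≤pred[a+b] G′ u₁) (<⇒≤pred (deg<a G′ u₂ tt (¬BNbr⇒nbrs-in-A G′ ¬bNbr₂))))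
          (deg≤1 G′ v u₁ λ vz →
            [ id , (λ { refl → ⊥-elim (¬bNbr₂ (v , symm G′ vz , tt)) }) ] (nbrs-of-v G′ ¬other vz))
        cases (no ¬other) (no ¬bNbr₁) (yes (y₂ , u₂y₂ , y₂∈B)) = pair-bound-lopsided v≡0
          (+-mono-≤-swap (pinned N₁⊆A u₂y₂ y₂∈B (≢-sym u₁≢u₂) (B≢A y₂∈B tt)) (<⇒≤pred (deg<a G u₂ tt N₂⊆A)))
          (+-mono-≤-swap (<⇒≤pred (deg<a G′ u₁ tt (¬BNbr⇒nbrs-in-A G′ ¬bNbr₁))) (deg≤pred[a+b] G′ u₂))
          (deg≤1 G′ v u₂ λ vz →
            [ (λ { refl → ⊥-elim (¬bNbr₁ (v , symm G′ vz , tt)) }) , id ] (nbrs-of-v G′ ¬other vz))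
        cases (no ¬other) (no ¬bNbr₁) (no ¬bNbr₂) = contradiction stray′
          [ ¬other , [ ¬bNbr₁ ∘ otherBNbr⇒bNbr {G′} , ¬bNbr₂ ∘ otherBNbr⇒bNbr {G′} ] ]

      pair-bound-one-stray : EdgesMeetA G → EdgesMeetA G′ → ¬ Stray G → Stray G′ →
                             2 + (degSum G + degSum G′) ≤ target a b
      pair-bound-one-stray meetsA meetsA′ ¬stray stray′ with adj? G u₁ v | adj? G u₂ v
      ... | yes u₁v | _       = pair-bound-spoked meetsA meetsA′ ¬stray stray′ (inj₁ u₁v)
      ... | no _    | yes u₂v = pair-bound-spoked meetsA meetsA′ ¬stray stray′ (inj₂ u₂v)
      ... | no ¬u₁v | no ¬u₂v = pair-bound-unspoked meetsA′ ¬stray ¬u₁v ¬u₂v stray′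

    -- The summand 2 is the room left for degSum G₁ when G₁ is a star at u₁ whose only leaf is u₂.
    pair-bound : (G G′ : Graph) → EdgesMeetA G → EdgesMeetA G′ → NoDisjointBEdges G G′ →
                 2 + (degSum G + degSum G′) ≤ target a b
    pair-bound G G′ meetsA meetsA′ B-apart with stray? G | stray? G′
    ... | no ¬stray | no ¬stray′ = ≤-trans
      (+-monoʳ-≤ 2 (+-mono-≤ (unstray-bound G ¬stray) (unstray-bound G′ ¬stray′))) (no-stray-total k m)
    ... | yes stray | yes stray′ = ≤-trans
      (+-monoʳ-≤ 2 (+-mono-≤
        (Pair.stray-confines G G′ B-apart stray′ (deg≤pred[a+b] G u₁) (deg≤pred[a+b] G u₂) (deg≤pred[a+b] G v))
        (Pair.stray-confines G′ G (NoDisjointBEdges-sym {G = G} {H = G′} B-apart) stray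
          (deg≤pred[a+b] G′ u₁) (deg≤pred[a+b] G′ u₂) (deg≤pred[a+b] G′ v))))
      (both-stray-total k m)
    ... | no ¬stray | yes stray′ = Pair.pair-bound-one-stray G G′ B-apart meetsA meetsA′ ¬stray stray′
    ... | yes stray | no ¬stray′ = subst (λ s → 2 + s ≤ target a b) (+-comm (degSum G′) (degSum G))
      (Pair.pair-bound-one-stray G′ G (NoDisjointBEdges-sym {G = G} {H = G′} B-apart) meetsA′ meetsA ¬stray′ stray)

  module Configuration (G₁ G₂ G₃ : Graph) (B-isolated : ∀ x y → Adj G₁ x y → InB x → ⊥)
                       (meetsA₂ : EdgesMeetA G₂) (meetsA₃ : EdgesMeetA G₃)
                       (apart₂ : NoDisjointEdges G₁ G₂) (apart₃ : NoDisjointEdges G₁ G₃)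
                       (B-apart : NoDisjointBEdges G₂ G₃) where

    G₁-nbrs⊆A : ∀ {t} → Adj G₁ t ⊆ InA
    G₁-nbrs⊆A {t} {y} ty with InA⊎InB y
    ... | inj₁ y∈A = y∈A
    ... | inj₂ y∈B = ⊥-elim (B-isolated y t (symm G₁ ty) y∈B)

    G₁-nbr≢B : ∀ {t x y} → Adj G₁ t x → InB y → x ≢ y
    G₁-nbr≢B tx = A≢B (G₁-nbrs⊆A tx)

    EdgeAvoiding : Vtx a b → Set
    EdgeAvoiding u = ∃₂ λ p q → Adj G₁ p q × p ≢ u × q ≢ u

    edge-avoiding? : (u : Vtx a b) → Dec (EdgeAvoiding u)
    edge-avoiding? u = ∃? λ p → ∃? λ q → adj? G₁ p q ×-dec ¬? (p ≟ u) ×-dec ¬? (q ≟ u)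

    module Total (i₁ i₂ : Fin a) (j : Fin b) (i₁≢i₂ : i₁ ≢ i₂) where
      open Triple i₁ i₂ j i₁≢i₂

      total : ℕ
      total = degSum G₁ + degSum G₂ + degSum G₃

      deg-G₁-v≡0 : deg G₁ v ≡ 0
      deg-G₁-v≡0 = deg≡0 G₁ v λ y vy → B-isolated v y vy tt

      two-avoiding : EdgeAvoiding u₁ → EdgeAvoiding u₂ → total ≤ target a b
      two-avoiding (p , q , pq , p≢u₁ , q≢u₁) (p′ , q′ , p′q′ , p′≢u₂ , q′≢u₂) = ≤-trans
        (+-mono-≤ (+-mono-≤ G₁-bound (confined G₂ apart₂)) (confined G₃ apart₃))
        (two-avoiding-total k m)
        where
        G₁-bound : degSum G₁ ≤ pred a + pred a + 0
        G₁-bound = +-mono-≤ (+-mono-≤ (<⇒≤pred (deg<a G₁ u₁ tt G₁-nbrs⊆A)) (<⇒≤pred (deg<a G₁ u₂ tt G₁-nbrs⊆A)))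
                            (≤-reflexive deg-G₁-v≡0)

        confined : (G : Graph) → NoDisjointEdges G₁ G → degSum G ≤ 2 + 2 + 2
        confined G apart = +-mono-≤
          (+-mono-≤ (deg≤2 G u₁ p q (edge-confines G₁ G apart pq p≢u₁ q≢u₁))
                    (deg≤2 G u₂ p′ q′ (edge-confines G₁ G apart p′q′ p′≢u₂ q′≢u₂)))
          (deg≤2 G v p q (edge-confines G₁ G apart pq (G₁-nbr≢B (symm G₁ pq) tt) (G₁-nbr≢B pq tt)))

      through-u₁ : ¬ EdgeAvoiding u₁ → ∀ {p q} → Adj G₁ p q → p ≡ u₁ ⊎ q ≡ u₁
      through-u₁ ¬avoid {p} {q} pq = decidable-stable ((p ≟ u₁) ⊎-dec (q ≟ u₁))
        λ neither → ¬avoid (p , q , pq , neither ∘ inj₁ , neither ∘ inj₂)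

      deg-G₁-u₂≤1 : ¬ EdgeAvoiding u₁ → deg G₁ u₂ ≤ 1
      deg-G₁-u₂≤1 ¬avoid = deg≤1 G₁ u₂ u₁ λ u₂y →
        [ (λ u₂≡u₁ → contradiction (sym u₂≡u₁) u₁≢u₂) , id ] (through-u₁ ¬avoid u₂y)

      star-no-leaf : ¬ EdgeAvoiding u₁ → (∀ {y} → Adj G₁ u₁ y → y ≡ u₂) → total ≤ target a b
      star-no-leaf ¬avoid nbr≡u₂ = begin
        degSum G₁ + degSum G₂ + degSum G₃   ≡⟨ +-assoc (degSum G₁) _ _ ⟩
        degSum G₁ + (degSum G₂ + degSum G₃) ≤⟨ +-monoˡ-≤ _ G₁-bound ⟩
        2 + (degSum G₂ + degSum G₃)         ≤⟨ pair-bound G₂ G₃ meetsA₂ meetsA₃ B-apart ⟩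
        target a b                          ∎
        where
        open ≤-Reasoning
        G₁-bound : degSum G₁ ≤ 2
        G₁-bound = +-mono-≤ (+-mono-≤ (deg≤1 G₁ u₁ u₂ nbr≡u₂) (deg-G₁-u₂≤1 ¬avoid)) (≤-reflexive deg-G₁-v≡0)

      star-two-leaves : ¬ EdgeAvoiding u₁ → ∀ {x x′} → Adj G₁ u₁ x → Adj G₁ u₁ x′ →
                        x ≢ u₂ → x′ ≢ u₂ → x′ ≢ x → total ≤ target a b
      star-two-leaves ¬avoid {x} {x′} u₁x u₁x′ x≢u₂ x′≢u₂ x′≢x = ≤-trans
        (+-mono-≤ (+-mono-≤ G₁-bound (confined G₂ apart₂)) (confined G₃ apart₃))
        (star-two-leaves-total k m)
        where
        G₁-bound : degSum G₁ ≤ pred a + 1 + 0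
        G₁-bound = +-mono-≤ (+-mono-≤ (<⇒≤pred (deg<a G₁ u₁ tt G₁-nbrs⊆A)) (deg-G₁-u₂≤1 ¬avoid))
                            (≤-reflexive deg-G₁-v≡0)

        only-u₁ : (G : Graph) → NoDisjointEdges G₁ G → ∀ {t} → u₁ ≢ t → x ≢ t → x′ ≢ t → deg G t ≤ 1
        only-u₁ G apart {t} u₁≢t x≢t x′≢t = deg≤1 G t u₁ λ tz →
          common-endpoint (edge-confines G₁ G apart u₁x u₁≢t x≢t tz)
                          (edge-confines G₁ G apart u₁x′ u₁≢t x′≢t tz) (≢-sym x′≢x)

        confined : (G : Graph) → NoDisjointEdges G₁ G → degSum G ≤ pred (a + b) + 1 + 1
        confined G apart = +-mono-≤
          (+-mono-≤ (deg≤pred[a+b] G u₁) (only-u₁ G apart u₁≢u₂ x≢u₂ x′≢u₂))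
          (only-u₁ G apart u₁≢v (G₁-nbr≢B u₁x tt) (G₁-nbr≢B u₁x′ tt))

      -- A B-neighbour y ≠ v of u₁ in G is paid for in G′, where u₂ and v are confined
      -- both to {u₁, x} by the G₁-edge u₁x and to {u₁, y} by the B-edge u₁y.
      cross-bound : (G G′ : Graph) → NoDisjointEdges G₁ G′ → NoDisjointBEdges G G′ →
                    ∀ {x} → Adj G₁ u₁ x → x ≢ u₂ →
                    deg G u₁ + (deg G′ u₂ + deg G′ v) ≤ (a + (2 + 2)) ⊔ (pred (a + b) + (1 + 1))
      cross-bound G G′ apart B-apart′ {x} u₁x x≢u₂ with otherBNbr? G u₁
      ... | yes (y , u₁y , y∈B , y≢v) = ≤-trans
        (+-mono-≤ (deg≤pred[a+b] G u₁) (+-mono-≤ (only-u₁ u₁≢u₂ x≢u₂ (B≢A y∈B tt))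
                                                   (only-u₁ u₁≢v (G₁-nbr≢B u₁x tt) y≢v)))
        (m≤n⊔m (a + (2 + 2)) (pred (a + b) + (1 + 1)))
        where
        only-u₁ : ∀ {t} → u₁ ≢ t → x ≢ t → y ≢ t → deg G′ t ≤ 1
        only-u₁ {t} u₁≢t x≢t y≢t = deg≤1 G′ t u₁ λ tz →
          common-endpoint (edge-confines G₁ G′ apart u₁x u₁≢t x≢t tz)
                          (B-edge-confines G G′ B-apart′ u₁y (inj₂ y∈B) u₁≢t y≢t tz) (G₁-nbr≢B u₁x y∈B)
      ... | no ¬other = ≤-trans
        (+-mono-≤ (deg≤a-no-otherBNbr G tt ¬other)
                  (+-mono-≤ (deg≤2 G′ u₂ u₁ x (edge-confines G₁ G′ apart u₁x u₁≢u₂ x≢u₂))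
                            (deg≤2 G′ v u₁ x (edge-confines G₁ G′ apart u₁x u₁≢v (G₁-nbr≢B u₁x tt)))))
        (m≤m⊔n (a + (2 + 2)) (pred (a + b) + (1 + 1)))

      star-one-leaf : ¬ EdgeAvoiding u₁ → ∀ {x} → Adj G₁ u₁ x → x ≢ u₂ →
                      (∀ {y} → Adj G₁ u₁ y → y ≡ u₂ ⊎ y ≡ x) → total ≤ target a b
      star-one-leaf ¬avoid {x} u₁x x≢u₂ nbr∈u₂x = ≤-trans
        (≤-reflexive (regroup-crosswise (degSum G₁) (deg G₂ u₁) (deg G₂ u₂) (deg G₂ v)
                                                       (deg G₃ u₁) (deg G₃ u₂) (deg G₃ v)))
        (≤-trans (+-mono-≤ (+-mono-≤ G₁-bound (cross-bound G₂ G₃ apart₃ B-apart u₁x x≢u₂))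
                           (cross-bound G₃ G₂ apart₂ (NoDisjointBEdges-sym {G = G₂} {H = G₃} B-apart) u₁x x≢u₂))
                 (star-one-leaf-total k m))
        where
        G₁-bound : degSum G₁ ≤ 2 + 1 + 0
        G₁-bound = +-mono-≤ (+-mono-≤ (deg≤2 G₁ u₁ u₂ x nbr∈u₂x) (deg-G₁-u₂≤1 ¬avoid)) (≤-reflexive deg-G₁-v≡0)

      star : ¬ EdgeAvoiding u₁ → total ≤ target a b
      star ¬avoid with ∃? (λ x → adj? G₁ u₁ x ×-dec ¬? (x ≟ u₂))
      ... | no ¬leaf = star-no-leaf ¬avoid λ {y} u₁y →
        decidable-stable (y ≟ u₂) λ y≢u₂ → ¬leaf (y , u₁y , y≢u₂)
      ... | yes (x , u₁x , x≢u₂) with ∃? (λ x′ → adj? G₁ u₁ x′ ×-dec ¬? (x′ ≟ u₂) ×-dec ¬? (x′ ≟ x))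
      ...   | yes (x′ , u₁x′ , x′≢u₂ , x′≢x) = star-two-leaves ¬avoid u₁x u₁x′ x≢u₂ x′≢u₂ x′≢x
      ...   | no ¬leaf′ = star-one-leaf ¬avoid u₁x x≢u₂ λ {y} u₁y →
        decidable-stable ((y ≟ u₂) ⊎-dec (y ≟ x)) λ neither → ¬leaf′ (y , u₁y , neither ∘ inj₁ , neither ∘ inj₂)

    bound : (i₁ i₂ : Fin a) (j : Fin b) (i₁≢i₂ : i₁ ≢ i₂) → Total.total i₁ i₂ j i₁≢i₂ ≤ target a b
    bound i₁ i₂ j i₁≢i₂ with edge-avoiding? (inj₁ i₁) | edge-avoiding? (inj₁ i₂)
    ... | yes avoid₁ | yes avoid₂ = Total.two-avoiding i₁ i₂ j i₁≢i₂ avoid₁ avoid₂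
    ... | no ¬avoid₁ | _          = Total.star i₁ i₂ j i₁≢i₂ ¬avoid₁
    ... | yes _      | no ¬avoid₂ =
      subst (_≤ target a b) (cong₂ _+_ (cong₂ _+_ (swap-u G₁) (swap-u G₂)) (swap-u G₃))
            (Total.star i₂ i₁ j (≢-sym i₁≢i₂) ¬avoid₂)
      where
      swap-u : (G : Graph) → deg G (inj₁ i₂) + deg G (inj₁ i₁) + deg G (inj₂ j)
                           ≡ deg G (inj₁ i₁) + deg G (inj₁ i₂) + deg G (inj₂ j)
      swap-u G = cong (_+ deg G (inj₂ j)) (+-comm (deg G (inj₁ i₂)) (deg G (inj₁ i₁)))

lemma14 : (a b : ℕ) → (ha : 3 ≤ a) → (hb : 1 ≤ b) →
  (G₁ G₂ G₃ : SimpleGraph (Vtx a b)) →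
  -- every vertex of B is isolated in G₁
  (∀ (x y : Vtx a b) → Adj G₁ x y → InB x → ⊥) →
  -- every edge of G₂, G₃ contains a vertex of A
  (∀ (x y : Vtx a b) → Adj G₂ x y → InA x ⊎ InA y) →
  (∀ (x y : Vtx a b) → Adj G₃ x y → InA x ⊎ InA y) →
  -- (i) no disjoint edges e ∈ G₁, f ∈ G₂ ∪ G₃
  (∀ (x y z w : Vtx a b) → Adj G₁ x y → Adj G₂ z w ⊎ Adj G₃ z w →
     ¬ Disjoint x y z w) →
  -- (ii) no disjoint edges e ∈ G₂, f ∈ G₃ with one of them meeting B
  (∀ (x y z w : Vtx a b) → Adj G₂ x y → Adj G₃ z w →
     InB x ⊎ InB y ⊎ InB z ⊎ InB w → ¬ Disjoint x y z w) →
  let u₁ : Vtx a b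
      u₁ = inj₁ (fromℕ< {0} {a} (≤-trans (s≤s z≤n) ha))
      u₂ : Vtx a b
      u₂ = inj₁ (fromℕ< {1} {a} (≤-trans (s≤s (s≤s z≤n)) ha))
      v₁ : Vtx a b
      v₁ = inj₂ (fromℕ< {0} {b} hb)
  in (deg G₁ u₁ + deg G₁ u₂ + deg G₁ v₁)
     + (deg G₂ u₁ + deg G₂ u₂ + deg G₂ v₁)
     + (deg G₃ u₁ + deg G₃ u₂ + deg G₃ v₁)
     ≤ (4 * a + 7) ⊔ (3 * a + 2 * b + 5)
lemma14 (suc (suc (suc k))) (suc m) (s≤s (s≤s (s≤s z≤n))) (s≤s z≤n)
        G₁ G₂ G₃ B-isolated meetsA₂ meetsA₃ apart B-apart =
  bound G₁ G₂ G₃ B-isolated meetsA₂ meetsA₃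
        (λ x y z w xy zw → apart x y z w xy (inj₁ zw)) (λ x y z w xy zw → apart x y z w xy (inj₂ zw)) B-apart
        zero (suc zero) zero (λ ())
  where open Bounds.Configuration k m
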